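{- Let $\mathcal{C}=((i_1,j_1),\dots,(i_u,j_u))$ and $\mathcal{C}'=((i'_1,j'_1),\dots,(i'_{u'},j'_{u'}))$ be two chains with $(i_1,j_1)=(i'_1,j'_1)$, $(i_u,j_u)=(i'_{u'},j'_{u'})$, and $\mathcal{C}'\subseteq\mathcal{C}$ (every anchor of $\mathcal{C}'$ is an anchor of $\mathcal{C}$). Then the extension runtime through $\mathcal{C}'$ is at least the extension runtime through $\mathcal{C}$: $T_{Ext}(\mathcal{C}')\ge T_{Ext}(\mathcal{C})$.
   Context: Fix a positive integer $k$. A chain is a sequence of integer pairs (anchors) $((i_1,j_1),\dots,(i_u,j_u))$ with $i_\ell<i_{\ell+1}$ and $j_\ell\le j_{\ell+1}$. The extension runtime of a chain is $T_{Ext}(\mathcal{C})=\sum_{\ell=1}^{u-1}G_\ell(S;\mathcal{C})\,G_\ell(S';\mathcal{C})$, where $G_\ell(S;\mathcal{C})=\max(i_{\ell+1}-i_\ell-k+1,0)$ and $G_\ell(S';\mathcal{C})=\max(j_{\ell+1}-j_\ell-k+1,0)$ (the cost of quadratic dynamic programming in the gap between consecutive anchors). -}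

module Defs where

open import Data.Integer using (ℤ; _+_; _-_; _*_; _≤_; _<_; _⊔_; +_; 0ℤ; 1ℤ)
open import Data.Nat using (ℕ)
open import Data.Product using (_×_; _,_; proj₁; proj₂)
open import Data.List using (List; []; _∷_)
open import Data.Unit using (⊤)

Anchor : Set
Anchor = ℤ × ℤ

Step : Anchor → Anchor → Set
Step (i , j) (i' , j') = (i < i') × (j ≤ j')

IsChain : List Anchor → Set
IsChain [] = ⊤
IsChain (a ∷ []) = ⊤
IsChain (a ∷ b ∷ rest) = Step a b × IsChain (b ∷ rest)

gap : ℕ → ℤ → ℤ → ℤ
gap k x x' = (x' - x - + k + 1ℤ) ⊔ 0ℤ

gapCost : ℕ → Anchor → Anchor → ℤ
gapCost k (i , j) (i' , j') = gap k i i' * gap k j j'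

TExt : ℕ → List Anchor → ℤ
TExt k [] = 0ℤ
TExt k (a ∷ []) = 0ℤ
TExt k (a ∷ b ∷ rest) = gapCost k a b + TExt k (b ∷ rest)

-- For anchors a ≼ b ≼ c (componentwise) and k ≥ 1 the gap is
-- superadditive, G(a,b) + G(b,c) ≤ G(a,c), because the k − 1 positions
-- subtracted from a gap are paid only once when two gaps are merged.  Since
-- p₁q₁ + p₂q₂ ≤ (p₁ + p₂)(q₁ + q₂) for naturals, the cost of a gap is
-- superadditive too, so deleting an interior anchor never lowers T_Ext.  As
-- both chains are strictly increasing in the first coordinate, C' ⊆ C as sets
-- makes C' a sublist of C with the same endpoints, so C' arises from C by
-- deleting interior anchors one at a time.
module Submission where

open import Defs
open import Data.Nat as ℕ using (ℕ; suc; NonZero; _∸_)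
import Data.Nat.Properties as ℕ
import Data.Nat.Tactic.RingSolver as ℕ-Solver
open import Data.Integer as ℤ using (ℤ; +_; _⊖_; ∣_∣; 0ℤ; 1ℤ; _⊔_; _+_; _-_; _≤_; _<_; +≤+)
import Data.Integer.Properties as ℤ
open import Data.Integer.Tactic.RingSolver using (solve-∀)
open import Data.List using (List; []; _∷_; head; last)
open import Data.List.Membership.Propositional using (_∈_)
open import Data.List.Relation.Unary.Any as Any using (here; there)
open import Data.List.Relation.Unary.All as All using ()
open import Data.List.Relation.Unary.AllPairs using (AllPairs; []; _∷_)
open import Data.List.Relation.Unary.Linked as Linked using (Linked; []; [-]; _∷_)
open import Data.List.Relation.Unary.Linked.Properties using (Linked⇒AllPairs)
open import Data.List.Relation.Binary.Sublist.Propositional using (_⊆_; []; _∷_; _∷ʳ_; minimum)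
open import Data.List.Relation.Binary.Sublist.Propositional.Properties using (∷⁻)
open import Data.Maybe.Properties using (just-injective)
open import Data.Product using (_×_; _,_; proj₁; proj₂)
open import Data.Sum using (inj₁; inj₂)
open import Data.Empty using (⊥-elim)
open import Function using (_on_)
open import Level using (Level; 0ℓ)
open import Relation.Binary using (Rel; Asymmetric; Transitive; Irreflexive)
open import Relation.Binary.PropositionalEquality

∸-superadditive : ∀ k m n → (m ∸ k) ℕ.+ (n ∸ k) ℕ.≤ (m ℕ.+ n) ∸ k
∸-superadditive k m n with ℕ.≤-<-connex k m
... | inj₁ k≤m rewrite ℕ.+-∸-comm n k≤m = ℕ.+-monoʳ-≤ (m ∸ k) (ℕ.m∸n≤m n k)
... | inj₂ m<k rewrite ℕ.m≤n⇒m∸n≡0 (ℕ.<⇒≤ m<k) = ℕ.∸-monoˡ-≤ k (ℕ.m≤n+m n m)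

*-superadditive : ∀ {p₁ p₂ q₁ q₂ P Q} → p₁ ℕ.+ p₂ ℕ.≤ P → q₁ ℕ.+ q₂ ℕ.≤ Q →
                  p₁ ℕ.* q₁ ℕ.+ p₂ ℕ.* q₂ ℕ.≤ P ℕ.* Q
*-superadditive {p₁} {p₂} {q₁} {q₂} {P} {Q} p≤P q≤Q = begin
  p₁ ℕ.* q₁ ℕ.+ p₂ ℕ.* q₂                                         ≤⟨ ℕ.m≤m+n _ _ ⟩
  p₁ ℕ.* q₁ ℕ.+ p₂ ℕ.* q₂ ℕ.+ (p₁ ℕ.* q₂ ℕ.+ p₂ ℕ.* q₁)         ≡⟨ expand p₁ p₂ q₁ q₂ ⟨
  (p₁ ℕ.+ p₂) ℕ.* (q₁ ℕ.+ q₂)                                     ≤⟨ ℕ.*-mono-≤ p≤P q≤Q ⟩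
  P ℕ.* Q                                                         ∎
  where
  open ℕ.≤-Reasoning
  expand : ∀ p₁ p₂ q₁ q₂ → (p₁ ℕ.+ p₂) ℕ.* (q₁ ℕ.+ q₂)
         ≡ p₁ ℕ.* q₁ ℕ.+ p₂ ℕ.* q₂ ℕ.+ (p₁ ℕ.* q₂ ℕ.+ p₂ ℕ.* q₁)
  expand = ℕ-Solver.solve-∀

m⊖n⊔0≡m∸n : ∀ m n → (m ⊖ n) ⊔ 0ℤ ≡ + (m ∸ n)
m⊖n⊔0≡m∸n m n with ℕ.≤-<-connex n m
... | inj₁ n≤m rewrite ℤ.⊖-≥ n≤m = cong +_ (ℕ.⊔-identityʳ (m ∸ n))
... | inj₂ m<n rewrite ℤ.⊖-< m<n | ℕ.m≤n⇒m∸n≡0 (ℕ.<⇒≤ m<n) =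
  ℤ.i≤j⇒i⊔j≡j (ℤ.neg-mono-≤ (+≤+ ℕ.z≤n))

+∣j-i∣≡j-i : ∀ {i j} → i ≤ j → + ∣ j - i ∣ ≡ j - i
+∣j-i∣≡j-i i≤j = ℤ.0≤i⇒+∣i∣≡i (ℤ.i≤j⇒0≤j-i i≤j)

∣k-i∣≡∣j-i∣+∣k-j∣ : ∀ {i j k} → i ≤ j → j ≤ k → ∣ k - i ∣ ≡ ∣ j - i ∣ ℕ.+ ∣ k - j ∣
∣k-i∣≡∣j-i∣+∣k-j∣ {i} {j} {k} i≤j j≤k = ℤ.+-injective (begin
  + ∣ k - i ∣                   ≡⟨ +∣j-i∣≡j-i (ℤ.≤-trans i≤j j≤k) ⟩
  k - i                         ≡⟨ telescope i j k ⟩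
  (j - i) + (k - j)             ≡⟨ cong₂ _+_ (+∣j-i∣≡j-i i≤j) (+∣j-i∣≡j-i j≤k) ⟨
  + ∣ j - i ∣ + + ∣ k - j ∣     ≡⟨ ℤ.pos-+ ∣ j - i ∣ ∣ k - j ∣ ⟨
  + (∣ j - i ∣ ℕ.+ ∣ k - j ∣)   ∎)
  where
  open ≡-Reasoning
  telescope : ∀ i j k → k - i ≡ (j - i) + (k - j)
  telescope = solve-∀

gapℕ : ℕ → ℤ → ℤ → ℕ
gapℕ k x y = suc ∣ y - x ∣ ∸ k

gap≡gapℕ : ∀ k {x y} → x ≤ y → gap k x y ≡ + gapℕ k x y
gap≡gapℕ k {x} {y} x≤y = begin
  (y - x - + k + 1ℤ) ⊔ 0ℤ     ≡⟨ cong (λ d → (d - + k + 1ℤ) ⊔ 0ℤ) (+∣j-i∣≡j-i x≤y) ⟨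
  (+ d - + k + 1ℤ) ⊔ 0ℤ       ≡⟨ cong (_⊔ 0ℤ) (shift (+ d) (+ k)) ⟩
  (+ suc d - + k) ⊔ 0ℤ        ≡⟨ cong (_⊔ 0ℤ) (ℤ.m-n≡m⊖n (suc d) k) ⟩
  (suc d ⊖ k) ⊔ 0ℤ            ≡⟨ m⊖n⊔0≡m∸n (suc d) k ⟩
  + (suc d ∸ k)               ∎
  where
  open ≡-Reasoning
  d = ∣ y - x ∣
  shift : ∀ a b → a - b + 1ℤ ≡ (1ℤ + a) - b
  shift = solve-∀

-- This is where k ≥ 1 is needed: for k = 0 merging two gaps loses 1.
gapℕ-superadditive : ∀ k .{{_ : NonZero k}} {x y z} → x ≤ y → y ≤ z →
                     gapℕ k x y ℕ.+ gapℕ k y z ℕ.≤ gapℕ k x z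
gapℕ-superadditive (suc k) {x} {y} {z} x≤y y≤z
  rewrite ∣k-i∣≡∣j-i∣+∣k-j∣ x≤y y≤z = ∸-superadditive k ∣ y - x ∣ ∣ z - y ∣

_≼_ : Anchor → Anchor → Set
(i , j) ≼ (i' , j') = i ≤ i' × j ≤ j'

gapCost≡ : ∀ k {a b} → a ≼ b →
           gapCost k a b ≡ + (gapℕ k (proj₁ a) (proj₁ b) ℕ.* gapℕ k (proj₂ a) (proj₂ b))
gapCost≡ k {i , j} {i' , j'} (i≤i' , j≤j') =
  trans (cong₂ ℤ._*_ (gap≡gapℕ k i≤i') (gap≡gapℕ k j≤j'))
        (sym (ℤ.pos-* (gapℕ k i i') (gapℕ k j j')))

gapCost-superadditive : ∀ k .{{_ : NonZero k}} {a b c} → a ≼ b → b ≼ c →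
                        gapCost k a b + gapCost k b c ≤ gapCost k a c
gapCost-superadditive k {a@(i₁ , j₁)} {b@(i₂ , j₂)} {c@(i₃ , j₃)}
                      a≼b@(i₁≤i₂ , j₁≤j₂) b≼c@(i₂≤i₃ , j₂≤j₃) = begin
  gapCost k a b + gapCost k b c
    ≡⟨ cong₂ _+_ (gapCost≡ k a≼b) (gapCost≡ k b≼c) ⟩
  + (gapℕ k i₁ i₂ ℕ.* gapℕ k j₁ j₂) + + (gapℕ k i₂ i₃ ℕ.* gapℕ k j₂ j₃)
    ≡⟨ ℤ.pos-+ (gapℕ k i₁ i₂ ℕ.* gapℕ k j₁ j₂) (gapℕ k i₂ i₃ ℕ.* gapℕ k j₂ j₃) ⟨
  + (gapℕ k i₁ i₂ ℕ.* gapℕ k j₁ j₂ ℕ.+ gapℕ k i₂ i₃ ℕ.* gapℕ k j₂ j₃)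
    ≤⟨ +≤+ (*-superadditive {gapℕ k i₁ i₂} {gapℕ k i₂ i₃} {gapℕ k j₁ j₂} {gapℕ k j₂ j₃}
                            (gapℕ-superadditive k i₁≤i₂ i₂≤i₃)
                            (gapℕ-superadditive k j₁≤j₂ j₂≤j₃)) ⟩
  + (gapℕ k i₁ i₃ ℕ.* gapℕ k j₁ j₃)
    ≡⟨ gapCost≡ k (ℤ.≤-trans i₁≤i₂ i₂≤i₃ , ℤ.≤-trans j₁≤j₂ j₂≤j₃) ⟨
  gapCost k a c
    ∎
  where open ℤ.≤-Reasoning

Step⇒≼ : ∀ {a b} → Step a b → a ≼ b
Step⇒≼ {_ , _} {_ , _} (i<i' , j≤j') = ℤ.<⇒≤ i<i' , j≤j'

_<₁_ : Rel Anchor 0ℓ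
_<₁_ = _<_ on proj₁

Step⇒<₁ : ∀ {a b} → Step a b → a <₁ b
Step⇒<₁ {_ , _} {_ , _} (i<i' , _) = i<i'

Step-trans : Transitive Step
Step-trans {_ , _} {_ , _} {_ , _} (i<i' , j≤j') (i'<i'' , j'≤j'') =
  ℤ.<-trans i<i' i'<i'' , ℤ.≤-trans j≤j' j'≤j''

Step-irrefl : Irreflexive _≡_ Step
Step-irrefl {_ , _} refl (i<i , _) = ℤ.<-irrefl refl i<i

IsChain⇒Linked : ∀ C → IsChain C → Linked Step C
IsChain⇒Linked []            _              = []
IsChain⇒Linked (_ ∷ [])      _              = [-]
IsChain⇒Linked (_ ∷ b ∷ C)   (step , chain) = step ∷ IsChain⇒Linked (b ∷ C) chain

TExt-delete : ∀ k .{{_ : NonZero k}} {a c d r} → Step a c → Step c d →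
              TExt k (a ∷ c ∷ d ∷ r) ≤ TExt k (a ∷ d ∷ r)
TExt-delete k {a} {c} {d} {r} a~c c~d = begin
  gapCost k a c + (gapCost k c d + T)   ≡⟨ ℤ.+-assoc (gapCost k a c) (gapCost k c d) T ⟨
  gapCost k a c + gapCost k c d + T     ≤⟨ ℤ.+-monoˡ-≤ T (gapCost-superadditive k (Step⇒≼ a~c) (Step⇒≼ c~d)) ⟩
  gapCost k a d + T                     ∎
  where
  open ℤ.≤-Reasoning
  T = TExt k (d ∷ r)

TExt-antimono-⊆ : ∀ k .{{_ : NonZero k}} {a r r'} → Linked Step (a ∷ r) → r' ⊆ r →
                  last (a ∷ r') ≡ last (a ∷ r) → TExt k (a ∷ r) ≤ TExt k (a ∷ r')
TExt-antimono-⊆ k _ [] _ = ℤ.≤-refl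
TExt-antimono-⊆ k (a~c ∷ [-]) (_ ∷ʳ []) a≡c = ⊥-elim (Step-irrefl (just-injective a≡c) a~c)
TExt-antimono-⊆ k {r = _ ∷ _ ∷ r} (a~c ∷ c~d ∷ chain) (_ ∷ʳ r'⊆d∷r) ends =
  ℤ.≤-trans (TExt-delete k {r = r} a~c c~d)
            (TExt-antimono-⊆ k (Step-trans a~c c~d ∷ chain) r'⊆d∷r ends)
TExt-antimono-⊆ k {a} {c ∷ _} (_ ∷ chain) (refl ∷ r'⊆r) ends =
  ℤ.+-monoʳ-≤ (gapCost k a c) (TExt-antimono-⊆ k chain r'⊆r ends)

module _ {a r : Level} {A : Set a} {R : Rel A r} (asym : Asymmetric R) where

  AllPairs-∈⇒⊆ : ∀ {xs ys} → AllPairs R xs → AllPairs R ys →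
                 (∀ {z} → z ∈ xs → z ∈ ys) → xs ⊆ ys
  AllPairs-∈⇒⊆ {[]}     _ _ _ = minimum _
  AllPairs-∈⇒⊆ {_ ∷ _}  {[]} _ _ incl with () ← incl (here refl)
  AllPairs-∈⇒⊆ {x ∷ xs} {y ∷ ys} (x<xs ∷ sorted-xs) (y<ys ∷ sorted-ys) incl
    with incl (here refl)
  ... | here refl = refl ∷ AllPairs-∈⇒⊆ sorted-xs sorted-ys xs⊆ys
    where
    xs⊆ys : ∀ {z} → z ∈ xs → z ∈ ys
    xs⊆ys z∈xs = Any.tail (λ { refl → let x<x = All.lookup x<xs z∈xs in asym x<x x<x })
                          (incl (there z∈xs))
  ... | there x∈ys = y ∷ʳ AllPairs-∈⇒⊆ (x<xs ∷ sorted-xs) sorted-ys x∷xs⊆ys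
    where
    y<x : R y x
    y<x = All.lookup y<ys x∈ys
    x∷xs⊆ys : ∀ {z} → z ∈ x ∷ xs → z ∈ ys
    x∷xs⊆ys (here refl)  = Any.tail (λ { refl → asym y<x y<x }) (incl (here refl))
    x∷xs⊆ys (there z∈xs) = Any.tail (λ { refl → asym y<x (All.lookup x<xs z∈xs) })
                                    (incl (there z∈xs))

IsChain⇒AllPairs : ∀ C → IsChain C → AllPairs _<₁_ C
IsChain⇒AllPairs C chain =
  Linked⇒AllPairs ℤ.<-trans (Linked.map Step⇒<₁ (IsChain⇒Linked C chain))

lemma24 : (k : ℕ) → .{{_ : NonZero k}} → (C C' : List Anchor) →
    IsChain C → IsChain C' → C ≢ [] →
    head C' ≡ head C → last C' ≡ last C →
    (∀ {a} → a ∈ C' → a ∈ C) →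
    TExt k C ≤ TExt k C'
lemma24 k []      _  _ _ C≢[] _ _ _ = ⊥-elim (C≢[] refl)
lemma24 k (_ ∷ _) [] _ _ _    () _ _
lemma24 k C@(a ∷ r) C'@(.a ∷ r') chain chain' _ refl ends ∈C'⇒∈C =
  TExt-antimono-⊆ k {a} {r} {r'} (IsChain⇒Linked C chain) (∷⁻ C'⊆C) ends
  where
  C'⊆C : C' ⊆ C
  C'⊆C = AllPairs-∈⇒⊆ ℤ.<-asym (IsChain⇒AllPairs C' chain') (IsChain⇒AllPairs C chain) ∈C'⇒∈C
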